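{- Let $a,b,c$ be positive integers with $c>b$ and $b\ge 2a$. The outcome sequence of the game $(\{a,b\},\{c\})$ is $\mathcal P^a\mathcal L^{c-a}\mathcal N^a\mathcal L^\infty$; that is, $o(n)=\mathcal P$ for $0\le n<a$, $o(n)=\mathcal L$ for $a\le n<c$, $o(n)=\mathcal N$ for $c\le n<c+a$, and $o(n)=\mathcal L$ for all $n\ge c+a$.
   Context: A partizan subtraction game $(S_L,S_R)$, with $S_L,S_R$ finite sets of positive integers, is played on a heap of $n$ tokens. Two players, Left and Right, alternate moves; Left removes $s\in S_L$ tokens and Right removes $s\in S_R$ tokens (at most the current heap size). A player unable to move loses. The outcome $o(n)$ is $\mathcal L$ (Left wins whoever starts), $\mathcal R$ (Right wins whoever starts), $\mathcal N$ (first player wins) or $\mathcal P$ (second player wins). -}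

module Defs where

open import Data.Nat using (ℕ; zero; suc; _∸_; _≤_; _<_; _≤?_; z≤n; s≤s)
open import Data.Nat.Properties using (∸-monoʳ-<; ≤-refl)
open import Data.Nat.Induction using (<-rec)
open import Data.Bool using (Bool; true; false; not; _∧_; _∨_)
open import Data.Product using (_×_; _,_; proj₁; proj₂)
open import Data.List using (List; []; _∷_)
open import Relation.Nullary using (yes; no)

-- A partizan subtraction game (S_L , S_R): finite sets of positive integers,
-- represented as lists (positivity is a hypothesis of the theorem using it).

-- For a heap of size n, compute the pair
--   (does Left win moving first? , does Right win moving first?)
-- A player moving first wins iff some legal move leads to a position where
-- the opponent, now moving first, does not win.

private
  anyMove : (n : ℕ) → (∀ {m} → m < n → Bool × Bool) →
            (Bool × Bool → Bool) → List ℕ → Bool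
  anyMove n rec sel [] = false
  anyMove n rec sel (zero ∷ ss) = anyMove n rec sel ss
  anyMove n rec sel (suc s ∷ ss) with suc s ≤? n
  ... | yes p = not (sel (rec (∸-monoʳ-< {n} {suc s} {0} (s≤s z≤n) p)))
                ∨ anyMove n rec sel ss
  ... | no _ = anyMove n rec sel ss

wins : (SL SR : List ℕ) → ℕ → Bool × Bool
wins SL SR = <-rec (λ _ → Bool × Bool) step
  where
  step : ∀ n → (∀ {m} → m < n → Bool × Bool) → Bool × Bool
  step n rec = anyMove n rec proj₂ SL , anyMove n rec proj₁ SR

LeftFirstWins : (SL SR : List ℕ) → ℕ → Bool
LeftFirstWins SL SR n = proj₁ (wins SL SR n)

RightFirstWins : (SL SR : List ℕ) → ℕ → Bool
RightFirstWins SL SR n = proj₂ (wins SL SR n)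

data Outcome : Set where
  𝓛 𝓡 𝓝 𝓟 : Outcome

outcome : (SL SR : List ℕ) → ℕ → Outcome
outcome SL SR n with LeftFirstWins SL SR n | RightFirstWins SL SR n
... | true  | false = 𝓛
... | false | true  = 𝓡
... | true  | true  = 𝓝
... | false | false = 𝓟

module Submission where

open import Defs
open import Data.Bool using (Bool; true; false; not; _∨_)
open import Data.Bool.ListAction using (any)
open import Data.Bool.Properties using (∨-zeroʳ)
open import Data.List using (List; []; _∷_)
open import Data.Nat
open import Data.Nat.Induction using (<′-wellFounded; <′-wellFounded′; <-wellFounded; <-rec)
open import Data.Nat.Properties
open import Data.Product using (_×_; _,_)
open import Data.Sum using (_⊎_; inj₁; inj₂)
open import Induction.WellFounded using (acc-inverse; module Subrelation)
open import Relation.Nullary using (yes; no; contradiction)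
open import Relation.Binary.PropositionalEquality

-- Left wins moving first exactly when n ≥ a, and Right wins moving first exactly
-- in the window c ≤ n < c + a; both claims go by simultaneous strong induction.
-- Right's only move leads to n − c, which is a loss for Left iff n − c < a.
-- From n ≥ a Left plays a, unless n − a lies in Right's window; then
-- n − b ≤ n − 2a < c, so playing b leaves Right stuck below c.

acc-inverse-<′-wellFounded : ∀ {m n} (m<n : m <′ n) → <′-wellFounded′ n m<n ≡ <′-wellFounded m
acc-inverse-<′-wellFounded <′-base        = refl
acc-inverse-<′-wellFounded (<′-step m<n) = acc-inverse-<′-wellFounded m<n

-- So the recursive call that <-rec makes at m < n is literally <-rec at m.
acc-inverse-<-wellFounded : ∀ {m n} (m<n : m < n) → acc-inverse (<-wellFounded n) m<n ≡ <-wellFounded m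
acc-inverse-<-wellFounded m<n =
  cong (Subrelation.accessible <⇒<′) (acc-inverse-<′-wellFounded (<⇒<′ m<n))

moveWins : (opponentFirstWins : ℕ → Bool) (n s : ℕ) → Bool
moveWins opponentFirstWins n s with s ≤? n
... | yes _ = not (opponentFirstWins (n ∸ s))
... | no  _ = false

moveWins-legal : ∀ {s n} w → s ≤ n → moveWins w n s ≡ not (w (n ∸ s))
moveWins-legal {s} {n} w s≤n with s ≤? n
... | yes _   = refl
... | no  s≰n = contradiction s≤n s≰n

moveWins-illegal : ∀ {s n} w → n < s → moveWins w n s ≡ false
moveWins-illegal {s} {n} w n<s with s ≤? n
... | yes s≤n = contradiction s≤n (<⇒≱ n<s)
... | no  _   = refl

-- Defs.wins scans the move list with a private helper, so the game rule "a player
-- wins moving first iff some move reaches a position the opponent loses moving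
-- first" can only be recovered for each concrete shape of move list.

LeftFirstWins-pair : ∀ {a b} SR n → 0 < a → 0 < b →
  LeftFirstWins (a ∷ b ∷ []) SR n ≡ any (moveWins (RightFirstWins (a ∷ b ∷ []) SR) n) (a ∷ b ∷ [])
LeftFirstWins-pair {suc a} {suc b} SR n z<s z<s with suc a ≤? n
... | yes a≤n rewrite acc-inverse-<-wellFounded (∸-monoʳ-< {n} z<s a≤n) with suc b ≤? n
...   | yes b≤n rewrite acc-inverse-<-wellFounded (∸-monoʳ-< {n} z<s b≤n) = refl
...   | no  _   = refl
LeftFirstWins-pair {suc a} {suc b} SR n z<s z<s | no _ with suc b ≤? n
...   | yes b≤n rewrite acc-inverse-<-wellFounded (∸-monoʳ-< {n} z<s b≤n) = refl
...   | no  _   = refl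

RightFirstWins-single : ∀ {c} SL n → 0 < c →
  RightFirstWins SL (c ∷ []) n ≡ any (moveWins (LeftFirstWins SL (c ∷ [])) n) (c ∷ [])
RightFirstWins-single {suc c} SL n z<s with suc c ≤? n
... | yes c≤n rewrite acc-inverse-<-wellFounded (∸-monoʳ-< {n} z<s c≤n) = refl
... | no _ = refl

module SubtractionGame {a b c : ℕ} (0<a : 0 < a) (0<b : 0 < b) (0<c : 0 < c)
                       (b<c : b < c) (2a≤b : 2 * a ≤ b) where

  SL SR : List ℕ
  SL = a ∷ b ∷ []
  SR = c ∷ []

  Lw Rw : ℕ → Bool
  Lw = LeftFirstWins SL SR
  Rw = RightFirstWins SL SR

  a+a≤b : a + a ≤ b
  a+a≤b = subst (_≤ b) (cong (a +_) (+-identityʳ a)) 2a≤b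

  a≤b : a ≤ b
  a≤b = ≤-trans (m≤m+n a a) a+a≤b

  a≤c : a ≤ c
  a≤c = ≤-trans a≤b (<⇒≤ b<c)

  b≤n-from-window : ∀ {n} → c ≤ n ∸ a → b ≤ n
  b≤n-from-window {n} c≤n∸a = ≤-trans (<⇒≤ b<c) (≤-trans c≤n∸a (m∸n≤m n a))

  n∸b<c-from-window : ∀ {n} → n ∸ a < c + a → n ∸ b < c
  n∸b<c-from-window {n} n∸a<c+a = begin-strict
    n ∸ b         ≤⟨ ∸-monoʳ-≤ n a+a≤b ⟩
    n ∸ (a + a)   ≡⟨ ∸-+-assoc n a a ⟨
    (n ∸ a) ∸ a   <⟨ m<n+o⇒m∸n<o (n ∸ a) a ⦃ >-nonZero 0<c ⦄
                       (subst (n ∸ a <_) (+-comm c a) n∸a<c+a) ⟩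
    c             ∎
    where open ≤-Reasoning

  left-moves : ∀ n → Lw n ≡ moveWins Rw n a ∨ (moveWins Rw n b ∨ false)
  left-moves n = LeftFirstWins-pair SR n 0<a 0<b

  right-moves : ∀ n → Rw n ≡ moveWins Lw n c ∨ false
  right-moves n = RightFirstWins-single SL n 0<c

  left-stuck : ∀ {n} → n < a → Lw n ≡ false
  left-stuck {n} n<a
    rewrite left-moves n | moveWins-illegal Rw n<a | moveWins-illegal Rw (<-≤-trans n<a a≤b) = refl

  left-wins-by-a : ∀ {n} → a ≤ n → Rw (n ∸ a) ≡ false → Lw n ≡ true
  left-wins-by-a {n} a≤n lost rewrite left-moves n | moveWins-legal Rw a≤n | lost = refl

  left-wins-by-b : ∀ {n} → b ≤ n → Rw (n ∸ b) ≡ false → Lw n ≡ true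
  left-wins-by-b {n} b≤n lost rewrite left-moves n | moveWins-legal Rw b≤n | lost = ∨-zeroʳ _

  right-stuck : ∀ {n} → n < c → Rw n ≡ false
  right-stuck {n} n<c rewrite right-moves n | moveWins-illegal Lw n<c = refl

  right-loses-by-c : ∀ {n} → c ≤ n → Lw (n ∸ c) ≡ true → Rw n ≡ false
  right-loses-by-c {n} c≤n won rewrite right-moves n | moveWins-legal Lw c≤n | won = refl

  right-wins-by-c : ∀ {n} → c ≤ n → Lw (n ∸ c) ≡ false → Rw n ≡ true
  right-wins-by-c {n} c≤n lost rewrite right-moves n | moveWins-legal Lw c≤n | lost = refl

  record Solved (n : ℕ) : Set where
    field
      left-loses  : n < a → Lw n ≡ false
      left-wins   : a ≤ n → Lw n ≡ true
      right-loses : n < c ⊎ c + a ≤ n → Rw n ≡ false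
      right-wins  : c ≤ n → n < c + a → Rw n ≡ true
  open Solved

  solved : ∀ n → Solved n
  solved = <-rec Solved step
    where
    step : ∀ n → (∀ {m} → m < n → Solved m) → Solved n
    step n ih = record
      { left-loses  = left-stuck
      ; left-wins   = left-wins′
      ; right-loses = right-loses′
      ; right-wins  = right-wins′
      }
      where
      after : ∀ {s} → 0 < s → s ≤ n → Solved (n ∸ s)
      after 0<s s≤n = ih (∸-monoʳ-< 0<s s≤n)

      left-wins′ : a ≤ n → Lw n ≡ true
      left-wins′ a≤n with c ≤? n ∸ a | c + a ≤? n ∸ a
      ... | no  c≰n∸a | _ = left-wins-by-a a≤n (right-loses (after 0<a a≤n) (inj₁ (≰⇒> c≰n∸a)))
      ... | yes _     | yes far = left-wins-by-a a≤n (right-loses (after 0<a a≤n) (inj₂ far))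
      ... | yes near  | no  far =
        left-wins-by-b b≤n (right-loses (after 0<b b≤n) (inj₁ (n∸b<c-from-window (≰⇒> far))))
        where b≤n = b≤n-from-window near

      right-loses′ : n < c ⊎ c + a ≤ n → Rw n ≡ false
      right-loses′ (inj₁ n<c) = right-stuck n<c
      right-loses′ (inj₂ c+a≤n) =
        right-loses-by-c c≤n
          (left-wins (after 0<c c≤n) (m+n≤o⇒m≤o∸n a (subst (_≤ n) (+-comm c a) c+a≤n)))
        where c≤n = m+n≤o⇒m≤o c c+a≤n

      right-wins′ : c ≤ n → n < c + a → Rw n ≡ true
      right-wins′ c≤n n<c+a =
        right-wins-by-c c≤n (left-loses (after 0<c c≤n) (m<n+o⇒m∸n<o n c ⦃ >-nonZero 0<a ⦄ n<c+a))

  outcome-𝓟 : ∀ n → n < a → outcome SL SR n ≡ 𝓟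
  outcome-𝓟 n n<a rewrite left-loses (solved n) n<a
                        | right-loses (solved n) (inj₁ (<-≤-trans n<a a≤c)) = refl

  outcome-𝓛-before-c : ∀ n → a ≤ n → n < c → outcome SL SR n ≡ 𝓛
  outcome-𝓛-before-c n a≤n n<c rewrite left-wins (solved n) a≤n
                                     | right-loses (solved n) (inj₁ n<c) = refl

  outcome-𝓝 : ∀ n → c ≤ n → n < c + a → outcome SL SR n ≡ 𝓝
  outcome-𝓝 n c≤n n<c+a rewrite left-wins (solved n) (≤-trans a≤c c≤n)
                              | right-wins (solved n) c≤n n<c+a = refl

  outcome-𝓛-from-c+a : ∀ n → c + a ≤ n → outcome SL SR n ≡ 𝓛
  outcome-𝓛-from-c+a n c+a≤n
    rewrite left-wins (solved n) (≤-trans a≤c (m+n≤o⇒m≤o c c+a≤n))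
          | right-loses (solved n) (inj₂ c+a≤n) = refl

mainTheorem11 : (a b c : ℕ) → 0 < a → 0 < b → 0 < c → b < c → 2 * a ≤ b →
    ((n : ℕ) → n < a → outcome (a ∷ b ∷ []) (c ∷ []) n ≡ 𝓟) ×
    ((n : ℕ) → a ≤ n → n < c → outcome (a ∷ b ∷ []) (c ∷ []) n ≡ 𝓛) ×
    ((n : ℕ) → c ≤ n → n < c + a → outcome (a ∷ b ∷ []) (c ∷ []) n ≡ 𝓝) ×
    ((n : ℕ) → c + a ≤ n → outcome (a ∷ b ∷ []) (c ∷ []) n ≡ 𝓛)
mainTheorem11 a b c 0<a 0<b 0<c b<c 2a≤b =
  outcome-𝓟 , outcome-𝓛-before-c , outcome-𝓝 , outcome-𝓛-from-c+a
  where open SubtractionGame 0<a 0<b 0<c b<c 2a≤b
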